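{- Let $\mu\in\mathbb{Z}^p_{\ge0}$ and $\mathbf n=(n_1,\dots,n_{p-1})\in[\ell]^{p-1}$ satisfy $n_{i+1}\ge n_i-1$ for all $i\in[p-2]$. A tableau $U\in\mathrm{SSYT}_\ell(\mu)$ is $\mathbf n$-katabolizable (in the first sense below) if and only if it is $(\mathrm{id},\mathsf c(n_1),\dots,\mathsf c(n_{p-1}))$-katabolizable (in the second sense below).
   Context: Tabloids: rows $1..\ell$ (top to bottom) of weakly increasing positive integers, $T^i$ the $i$-th row; content counts entries. $\mathrm{SSYT}_\ell(\mu)$: tabloids of content $\mu$ with partition shape and strictly increasing columns. $\mathrm{kat}(T)$: remove all 1's and left-justify, move row 1 to row $\ell$ (rows $2..\ell$ move up), subtract 1 from all entries. First sense: for $T$ whose rows $i,\dots,\ell-1$ form a tableau, $P_{i,\ell}(T)$ keeps rows $1..i-1$ and replaces rows $i..\ell$ by the tableau obtained by column inserting row $T^\ell$ into the tableau formed by rows $i..\ell-1$ (i.e. the Schensted insertion tableau of $T^\ell T^{\ell-1}\cdots T^i$). $U$ is $\mathbf n$-katabolizable if for all $i\in[p-1]$ the tabloid $P_{n_i,\ell}\circ\mathrm{kat}\circ\cdots\circ P_{n_2,\ell}\circ\mathrm{kat}\circ P_{n_1,\ell}\circ\mathrm{kat}(U)$ has all its 1's in its first row (each $P_{n_i,\ell}$ being applied where defined). Second sense: for $j\in[\ell-1]$, $P_j(T)$ replaces rows $j,j+1$ of $T$ by the Schensted insertion tableau of the word $T^{j+1}T^j$ (row $j+1$ empty if it has one row).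 $H_\ell$ is the 0-Hecke monoid on $\bar s_1,\dots,\bar s_{\ell-1}$ ($\bar s_i^2=\bar s_i$, commutation, braid); $P_w=P_{i_1}\cdots P_{i_m}$ for $w=\bar s_{i_1}\cdots\bar s_{i_m}$ (well defined), and $w^{ -1}=\bar s_{i_m}\cdots\bar s_{i_1}$. $\mathsf c(d)=\bar s_{\ell-1}\bar s_{\ell-2}\cdots\bar s_d$ (so $P_{\mathsf c(d)^{ -1}}=P_dP_{d+1}\cdots P_{\ell-1}$). For $\mathbf w=(w_1,\dots,w_r)\in H_\ell^r$, $T$ is $\mathbf w$-katabolizable if all 1's of $P_{w_1^{ -1}}(T)$ lie in its first row and $\mathrm{kat}(P_{w_1^{ -1}}(T))$ is $(w_2,\dots,w_r)$-katabolizable; for the empty sequence, only the empty tabloid is katabolizable. -}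

module Defs where

open import Data.Nat using (ℕ; zero; suc; _+_; _≤_; _<_; _∸_; _<ᵇ_; _≟_)
open import Data.Bool using (true; false)
open import Data.List using (List; []; _∷_; [_]; _++_; map; take; drop; length; concat; reverse; foldl; filter; upTo)
open import Data.Nat.ListAction using (sum)
open import Data.List.Relation.Unary.All using (All)
open import Data.List.Relation.Unary.Linked using (Linked)
open import Data.List.Membership.Propositional using (_∈_)
open import Data.Maybe using (Maybe; just; nothing)
open import Data.Product using (_×_; _,_)
open import Data.Vec using (Vec; toList; lookup) renaming ([] to []ᵥ; _∷_ to _∷ᵥ_)
open import Data.Fin using (Fin; toℕ)
open import Data.Unit using (⊤)
open import Relation.Nullary using (¬_; ¬?)
open import Relation.Binary.PropositionalEquality using (_≡_)

-- Tabloids with ℓ rows: row i (1-based, top to bottom) is the (i-1)-th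
-- entry of the vector.  The tabloid conditions (positive entries,
-- weakly increasing rows) are imposed as predicates where needed.

Tabloid : ℕ → Set
Tabloid ℓ = Vec (List ℕ) ℓ

-- turn a list of rows into exactly k rows (pad with empty rows; extra
-- rows are dropped, which never happens in the uses below since the
-- insertion tableau of a word made of m weakly increasing segments has
-- at most m rows)
padTo : ℕ → List (List ℕ) → List (List ℕ)
padTo zero    _        = []
padTo (suc k) []       = [] ∷ padTo k []
padTo (suc k) (r ∷ rs) = r ∷ padTo k rs

toTabloid : (ℓ : ℕ) → List (List ℕ) → Tabloid ℓ
toTabloid ℓ rs = go ℓ rs
  where
  go : (k : ℕ) → List (List ℕ) → Vec (List ℕ) k
  go zero    _        = []ᵥ
  go (suc k) []       = [] ∷ᵥ go k []
  go (suc k) (r ∷ rs) = r ∷ᵥ go k rs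

insertIntoRow : ℕ → List ℕ → List ℕ × Maybe ℕ
insertIntoRow x [] = [ x ] , nothing
insertIntoRow x (y ∷ ys) with x <ᵇ y
... | true  = x ∷ ys , just y
... | false with insertIntoRow x ys
...   | r , b = y ∷ r , b

rowInsert : ℕ → List (List ℕ) → List (List ℕ)
rowInsert x [] = [ [ x ] ]
rowInsert x (r ∷ rs) with insertIntoRow x r
... | r' , nothing = r' ∷ rs
... | r' , just y  = r' ∷ rowInsert y rs

insTab : List ℕ → List (List ℕ)
insTab w = foldl (λ t x → rowInsert x t) [] w

-- Block replacement: keep the first a rows, replace the next b rows
-- (rows a+1..a+b) by the insertion tableau of the word
-- T^{a+b} T^{a+b-1} ⋯ T^{a+1}, keep the remaining rows.

replaceBlock : {ℓ : ℕ} → ℕ → ℕ → Tabloid ℓ → Tabloid ℓ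
replaceBlock {ℓ} a b T =
  toTabloid ℓ (take a L ++ padTo b (insTab (concat (reverse (take b (drop a L))))) ++ drop (a + b) L)
  where
  L = toList T

-- First sense:  P_{i,ℓ}  (i ∈ [ℓ]), rows i..ℓ replaced by P(T^ℓ ⋯ T^i)
Pℓ : {ℓ : ℕ} → ℕ → Tabloid ℓ → Tabloid ℓ
Pℓ {ℓ} i T = replaceBlock (i ∸ 1) (suc (ℓ ∸ i)) T

-- Second sense:  P_j  (j ∈ [ℓ-1]), rows j,j+1 replaced by P(T^{j+1} T^j)
Pj : {ℓ : ℕ} → ℕ → Tabloid ℓ → Tabloid ℓ
Pj j T = replaceBlock (j ∸ 1) 2 T

removeOnes : List ℕ → List ℕ
removeOnes r = filter (λ x → ¬? (x ≟ 1)) r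

kat : {ℓ : ℕ} → Tabloid ℓ → Tabloid ℓ
kat {ℓ} T = toTabloid ℓ (map (λ r → map (_∸ 1) (removeOnes r)) (drop 1 L ++ take 1 L))
  where
  L = toList T

OnesInFirstRow : {ℓ : ℕ} → Tabloid ℓ → Set
OnesInFirstRow T = All (λ r → ¬ (1 ∈ r)) (drop 1 (toList T))

IsEmptyTabloid : {ℓ : ℕ} → Tabloid ℓ → Set
IsEmptyTabloid T = All (_≡ []) (toList T)

multiplicity : ℕ → List ℕ → ℕ
multiplicity v xs = length (filter (_≟ v) xs)

contentOf : {ℓ : ℕ} → ℕ → Tabloid ℓ → ℕ
contentOf v T = sum (map (multiplicity v) (toList T))

-- lower row ys lies below upper row xs with strictly increasing columns
-- (in particular ys is not longer than xs)
data ColStrict : List ℕ → List ℕ → Set where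
  done : ∀ {xs} → ColStrict xs []
  step : ∀ {x y xs ys} → x < y → ColStrict xs ys → ColStrict (x ∷ xs) (y ∷ ys)

HasContent : {ℓ p : ℕ} → Vec ℕ p → Tabloid ℓ → Set
HasContent {p = p} μ T =
  All (Linked _≤_) (toList T) ×
  All (All (λ x → 1 ≤ x × x ≤ p)) (toList T) ×
  ((i : Fin p) → contentOf (suc (toℕ i)) T ≡ lookup μ i)

PartitionShape : {ℓ : ℕ} → Tabloid ℓ → Set
PartitionShape T = Linked (λ r s → length s ≤ length r) (toList T)

ColumnStrict : {ℓ : ℕ} → Tabloid ℓ → Set
ColumnStrict T = Linked ColStrict (toList T)

SSYT : (ℓ : ℕ) {p : ℕ} → Vec ℕ p → Tabloid ℓ → Set
SSYT ℓ μ T = HasContent μ T × PartitionShape T × ColumnStrict T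

NKatAux : {ℓ : ℕ} → List ℕ → Tabloid ℓ → Set
NKatAux []       T = ⊤
NKatAux (n ∷ ns) T = OnesInFirstRow (Pℓ n (kat T)) × NKatAux ns (Pℓ n (kat T))

NKatabolizable : {ℓ k : ℕ} → Vec ℕ k → Tabloid ℓ → Set
NKatabolizable n U = NKatAux (toList n) U

-- Elements of the 0-Hecke monoid H_ℓ are represented by
-- words in the generators  s̄_i  (i ∈ [ℓ-1]), as lists of indices;
-- P_w is well defined on H_ℓ, and is computed from any word.

HeckeWord : Set
HeckeWord = List ℕ

Pw : {ℓ : ℕ} → HeckeWord → Tabloid ℓ → Tabloid ℓ
Pw []       T = T
Pw (i ∷ is) T = Pj i (Pw is T)

heckeInv : HeckeWord → HeckeWord
heckeInv w = reverse w

heckeId : HeckeWord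
heckeId = []

-- c(d) = s̄_{ℓ-1} s̄_{ℓ-2} ⋯ s̄_d
cyc : ℕ → ℕ → HeckeWord
cyc ℓ d = map (λ k → ℓ ∸ 1 ∸ k) (upTo (ℓ ∸ d))

WKatabolizable : {ℓ : ℕ} → List HeckeWord → Tabloid ℓ → Set
WKatabolizable []       T = IsEmptyTabloid T
WKatabolizable (w ∷ ws) T =
  OnesInFirstRow (Pw (heckeInv w) T) × WKatabolizable ws (kat (Pw (heckeInv w) T))

module Submission where

-- The core is that P_{c(i)⁻¹} = P_i P_{i+1} ⋯ P_{ℓ−1} and P_{i,ℓ} agree on every
-- tabloid whose rows i..ℓ−1 form a tableau (Pcyc≡Pℓ): both compute the column
-- insertion of row ℓ into that tableau.  For P_{i,ℓ} this holds because the
-- Schensted tableau of the reading word of a tableau followed by a row R is the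
-- column insertion of R (reading-colInsert); for P_{c(i)⁻¹} R slides up one row
-- at a time, the intermediate results being tableaux by the row-bumping lemma.
-- Then, by induction along n, every stage of the katabolism keeps weakly
-- increasing rows, a tableau from row n_i on, and entries bounded by the number
-- of remaining rounds; so the two recursions agree round by round, and after the
-- last round kat empties the tabloid (kat-round, katabolizable-iff).

open import Defs

module Lemmas where
  open import Data.Nat using (ℕ; zero; suc; _+_; _≤_; _<_; _∸_; _<ᵇ_; _≟_; z≤n; s≤s)
  open import Data.Nat.Properties using (suc-injective; m≤n⇒m⊓n≡m; m+[n∸m]≡n; ≤-antisym; ∸-monoˡ-≤; <-irrefl; +-suc; m+n∸m≡n; n∸n≡0; +-∸-assoc; m∸[m∸n]≡n; <ᵇ-reflects-<; ≤-trans; ≤-<-trans; <⇒≤; <⇒≱; ≮⇒≥)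
  open import Data.Bool using (true; false)
  open import Data.Empty using (⊥-elim)
  open import Data.List using (List; []; _∷_; [_]; _++_; foldl; take; drop; length; concat; reverse; map; upTo)
  open import Data.List.Properties using (drop-[]; foldl-++; unfold-reverse; concat-++; ++-identityʳ; length-++; drop-drop; map-++; reverse-++; upTo-∷ʳ; ++-assoc; length-map; filter-all; filter-none; take++drop≡id; length-take)
  open import Data.Vec using (Vec; toList) renaming ([] to []ᵥ; _∷_ to _∷ᵥ_)
  open import Data.Vec.Properties using (length-toList; toList-injective)
  open import Data.Vec.Relation.Binary.Equality.Cast using (cast-is-id)
  open import Data.Unit using (tt)
  open import Function.Bundles using (_⇔_; mk⇔; Equivalence)
  open import Data.List.Relation.Unary.All using (All; []; _∷_)
  import Data.List.Relation.Unary.All as All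
  import Data.List.Relation.Unary.All.Properties as Allₚ
  open import Data.List.Relation.Unary.Linked using (Linked; []; [-]; _∷_)
  import Data.List.Relation.Unary.Linked as Linked
  open import Data.List.Relation.Unary.Linked.Properties using (Linked⇒All)
  import Data.List.Relation.Unary.Linked.Properties as Linkedₚ
  open import Data.List.Membership.Propositional using (_∈_)
  open import Data.Maybe using (Maybe; just; nothing)
  open import Data.Product using (_×_; _,_; proj₁; proj₂)
  open import Relation.Nullary using (¬_; Dec; ¬?)
  open import Relation.Nullary.Reflects using (ofʸ; ofⁿ)
  open import Relation.Binary.PropositionalEquality using (_≡_; refl; sym; trans; cong; cong₂; subst; subst₂; module ≡-Reasoning)

  Sorted : List ℕ → Set
  Sorted = Linked _≤_

  sorted-head : ∀ {x w} → Sorted (x ∷ w) → All (x ≤_) w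
  sorted-head [-]      = []
  sorted-head (p ∷ l) = Linked⇒All ≤-trans p l

  sorted-cons : ∀ {a w} → All (a ≤_) w → Sorted w → Sorted (a ∷ w)
  sorted-cons []      _ = [-]
  sorted-cons (p ∷ _) l = p ∷ l

  all-weaken : ∀ {c d w} → c ≤ d → All (d ≤_) w → All (c ≤_) w
  all-weaken c≤d = All.map (≤-trans c≤d)

  -- Row insertion of a weakly increasing word w into a row r: the row
  -- becomes  newRow w r  and the bumped letters form the word  bumped w r.
  newRow : List ℕ → List ℕ → List ℕ
  newRow []      r       = r
  newRow (x ∷ w) []      = x ∷ w
  newRow (x ∷ w) (a ∷ r) with x <ᵇ a
  ... | true  = x ∷ newRow w r
  ... | false = a ∷ newRow (x ∷ w) r

  bumped : List ℕ → List ℕ → List ℕ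
  bumped []      r       = []
  bumped (x ∷ w) []      = []
  bumped (x ∷ w) (a ∷ r) with x <ᵇ a
  ... | true  = a ∷ bumped w r
  ... | false = bumped (x ∷ w) r

  insertWord : List ℕ → List (List ℕ) → List (List ℕ)
  insertWord w Q = foldl (λ t x → rowInsert x t) Q w

  newRow-[] : ∀ w → newRow w [] ≡ w
  newRow-[] []      = refl
  newRow-[] (x ∷ w) = refl

  bumped-[] : ∀ w → bumped w [] ≡ []
  bumped-[] []      = refl
  bumped-[] (x ∷ w) = refl

  newRow-skip : ∀ c w r → All (c ≤_) w → newRow w (c ∷ r) ≡ c ∷ newRow w r
  newRow-skip c []      r _         = refl
  newRow-skip c (x ∷ w) r (c≤x ∷ _) with x <ᵇ c | <ᵇ-reflects-< x c
  ... | true  | ofʸ x<c = ⊥-elim (<⇒≱ x<c c≤x)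
  ... | false | _       = refl

  bumped-skip : ∀ c w r → All (c ≤_) w → bumped w (c ∷ r) ≡ bumped w r
  bumped-skip c []      r _         = refl
  bumped-skip c (x ∷ w) r (c≤x ∷ _) with x <ᵇ c | <ᵇ-reflects-< x c
  ... | true  | ofʸ x<c = ⊥-elim (<⇒≱ x<c c≤x)
  ... | false | _       = refl

  push : Maybe ℕ → List ℕ → List ℕ
  push nothing  w = w
  push (just y) w = y ∷ w

  insert-first-letter : ∀ x w r → All (x ≤_) w →
    let (r′ , y) = insertIntoRow x r in
    newRow (x ∷ w) r ≡ newRow w r′ × bumped (x ∷ w) r ≡ push y (bumped w r′)
  insert-first-letter x w [] x≤w =
    sym (trans (newRow-skip x w [] x≤w) (cong (x ∷_) (newRow-[] w))) ,
    sym (trans (bumped-skip x w [] x≤w) (bumped-[] w))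
  insert-first-letter x w (a ∷ r) x≤w with x <ᵇ a | <ᵇ-reflects-< x a
  ... | true  | _       = sym (newRow-skip x w r x≤w) , cong (a ∷_) (sym (bumped-skip x w r x≤w))
  ... | false | ofⁿ x≮a with insertIntoRow x r | insert-first-letter x w r x≤w
  ...   | r′ , y | eqRow , eqBumped =
    trans (cong (a ∷_) eqRow) (sym (newRow-skip a w r′ a≤w)) ,
    trans eqBumped (cong (push y) (sym (bumped-skip a w r′ a≤w)))
    where
    a≤w : All (a ≤_) w
    a≤w = all-weaken (≮⇒≥ x≮a) x≤w

  insertWord-cons : ∀ w r Q → Sorted w →
    insertWord w (r ∷ Q) ≡ newRow w r ∷ insertWord (bumped w r) Q
  insertWord-cons []      r Q _  = refl
  insertWord-cons (x ∷ w) r Q sw with insert-first-letter x w r (sorted-head sw)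
  ... | eqRow , eqBumped rewrite eqRow | eqBumped with insertIntoRow x r
  ...   | r′ , nothing = insertWord-cons w r′ Q (Linked.tail sw)
  ...   | r′ , just y  = insertWord-cons w r′ (rowInsert y Q) (Linked.tail sw)

  newRow-All : ∀ {P : ℕ → Set} w r → All P w → All P r → All P (newRow w r)
  newRow-All []      r       _          pr         = pr
  newRow-All (x ∷ w) []      pw         _          = pw
  newRow-All (x ∷ w) (a ∷ r) (px ∷ pw) (pa ∷ pr) with x <ᵇ a
  ... | true  = px ∷ newRow-All w r pw pr
  ... | false = pa ∷ newRow-All (x ∷ w) r (px ∷ pw) pr

  bumped-All : ∀ {P : ℕ → Set} w r → All P r → All P (bumped w r)
  bumped-All []      r       _          = []
  bumped-All (x ∷ w) []      _          = []
  bumped-All (x ∷ w) (a ∷ r) (pa ∷ pr) with x <ᵇ a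
  ... | true  = pa ∷ bumped-All w r pr
  ... | false = bumped-All (x ∷ w) r pr

  bumped-sorted : ∀ w r → Sorted r → Sorted (bumped w r)
  bumped-sorted []      r       _  = []
  bumped-sorted (x ∷ w) []      _  = []
  bumped-sorted (x ∷ w) (a ∷ r) sr with x <ᵇ a
  ... | true  = sorted-cons (bumped-All w r (sorted-head sr)) (bumped-sorted w r (Linked.tail sr))
  ... | false = bumped-sorted (x ∷ w) r (Linked.tail sr)

  newRow-lower-bound : ∀ {a x w r} → a ≤ x → Sorted (x ∷ w) → Sorted (a ∷ r) → All (a ≤_) (newRow (x ∷ w) r)
  newRow-lower-bound {r = r} a≤x sw sr =
    newRow-All _ r (a≤x ∷ all-weaken a≤x (sorted-head sw)) (sorted-head sr)

  newRow-sorted : ∀ w r → Sorted w → Sorted r → Sorted (newRow w r)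
  newRow-sorted []      r       _  sr = sr
  newRow-sorted (x ∷ w) []      sw _  = sw
  newRow-sorted (x ∷ w) (a ∷ r) sw sr with x <ᵇ a | <ᵇ-reflects-< x a
  ... | true  | ofʸ x<a =
    sorted-cons (newRow-All w r (sorted-head sw) (all-weaken (<⇒≤ x<a) (sorted-head sr)))
                (newRow-sorted w r (Linked.tail sw) (Linked.tail sr))
  ... | false | ofⁿ x≮a =
    sorted-cons (newRow-lower-bound (≮⇒≥ x≮a) sw sr) (newRow-sorted (x ∷ w) r sw (Linked.tail sr))

  shift-right : ∀ {a u v} → Sorted (a ∷ u) → ColStrict u v → ColStrict (a ∷ u) v
  shift-right _         done         = done
  shift-right (a≤ ∷ su) (step lt cs) = step (≤-<-trans a≤ lt) (shift-right su cs)

  newRow-above-bumped : ∀ w r → Sorted w → Sorted r → ColStrict (newRow w r) (bumped w r)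
  newRow-above-bumped []      r       _  _  = done
  newRow-above-bumped (x ∷ w) []      _  _  = done
  newRow-above-bumped (x ∷ w) (a ∷ r) sw sr with x <ᵇ a | <ᵇ-reflects-< x a
  ... | true  | ofʸ x<a = step x<a (newRow-above-bumped w r (Linked.tail sw) (Linked.tail sr))
  ... | false | ofⁿ x≮a =
    shift-right (sorted-cons (newRow-lower-bound (≮⇒≥ x≮a) sw sr) (newRow-sorted (x ∷ w) r sw (Linked.tail sr)))
                (newRow-above-bumped (x ∷ w) r sw (Linked.tail sr))

  word-above-bumped : ∀ w r → ColStrict w (bumped w r)
  word-above-bumped []      r       = done
  word-above-bumped (x ∷ w) []      = done
  word-above-bumped (x ∷ w) (a ∷ r) with x <ᵇ a | <ᵇ-reflects-< x a
  ... | true  | ofʸ x<a = step x<a (word-above-bumped w r)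
  ... | false | _       = word-above-bumped (x ∷ w) r

  -- the row-bumping lemma below reads column strictness with the lower row
  -- shifted s columns to the left, ColStrict u (drop s v); these are the
  -- bookkeeping facts about that shifted relation

  below-strict : ∀ {c u v} → ColStrict u v → All (c ≤_) u → All (c <_) v
  below-strict done         _           = []
  below-strict (step lt cs) (c≤ ∷ c≤s) = ≤-<-trans c≤ lt ∷ below-strict cs c≤s

  prepend-shifted : ∀ {c u} k v → All (c <_) v → ColStrict u (drop (suc k) v) → ColStrict (c ∷ u) (drop k v)
  prepend-shifted k       []      _          _  rewrite drop-[] {A = ℕ} k = done
  prepend-shifted zero    (z ∷ v) (c<z ∷ _)  cs = step c<z cs
  prepend-shifted (suc k) (z ∷ v) (_ ∷ c<v) cs = prepend-shifted k v c<v cs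

  tail-shifted : ∀ {y u} k v → ColStrict (y ∷ u) (drop k v) → ColStrict u (drop (suc k) v)
  tail-shifted k       []      _             rewrite drop-[] {A = ℕ} (suc k) = done
  tail-shifted zero    (z ∷ v) (step _ cs) = cs
  tail-shifted (suc k) (z ∷ v) cs          = tail-shifted k v cs

  short-below : ∀ s {v b} → ColStrict [] (drop s v) → ColStrict v b → ColStrict [] (drop s b)
  short-below zero    done        done         = done
  short-below (suc s) {[]}        _ done       = done
  short-below (suc s) {z ∷ v}     _ done       = done
  short-below (suc s) {z ∷ v}     h (step _ cs) = short-below s h cs

  row-bumping-shifted : ∀ A x y s → Sorted x → ColStrict y (drop s x) →
    ColStrict (bumped y (newRow x A)) (drop s (bumped x A))
  row-bumping-shifted []      []       y s _ _ rewrite bumped-[] y | drop-[] {A = ℕ} s = done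
  row-bumping-shifted []      (x ∷ xs) y s _ _ rewrite drop-[] {A = ℕ} s = done
  row-bumping-shifted (a ∷ A) []       y s _ _ rewrite drop-[] {A = ℕ} s = done
  row-bumping-shifted (a ∷ A) (x ∷ xs) y s sx h with x <ᵇ a | <ᵇ-reflects-< x a
  row-bumping-shifted (a ∷ A) (x ∷ xs) [] s sx h | true | ofʸ x<a =
    short-below s h (step x<a (word-above-bumped xs A))
  row-bumping-shifted (a ∷ A) (x ∷ xs) (y ∷ ys) s sx h | true | ofʸ x<a
    with y <ᵇ x | <ᵇ-reflects-< y x
  row-bumping-shifted (a ∷ A) (x ∷ xs) (y ∷ ys) zero sx (step _ cs) | true | ofʸ x<a | true | _ =
    step x<a (row-bumping-shifted A xs ys zero (Linked.tail sx) cs)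
  row-bumping-shifted (a ∷ A) (x ∷ xs) (y ∷ ys) (suc s) sx h | true | ofʸ x<a | true | _ =
    prepend-shifted s (bumped xs A) (below-strict (word-above-bumped xs A) (sorted-head sx))
      (row-bumping-shifted A xs ys (suc s) (Linked.tail sx) (tail-shifted s xs h))
  row-bumping-shifted (a ∷ A) (x ∷ xs) (y ∷ ys) zero sx (step y<x _) | true | _ | false | ofⁿ y≮x =
    ⊥-elim (y≮x y<x)
  row-bumping-shifted (a ∷ A) (x ∷ xs) (y ∷ ys) (suc s) sx h | true | _ | false | _ =
    row-bumping-shifted A xs (y ∷ ys) s (Linked.tail sx) h
  row-bumping-shifted (a ∷ A) (x ∷ xs) [] s sx h | false | _ =
    short-below s h (word-above-bumped (x ∷ xs) A)
  row-bumping-shifted (a ∷ A) (x ∷ xs) (y ∷ ys) s sx h | false | ofⁿ x≮a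
    with y <ᵇ a
  ... | true  =
    prepend-shifted s (bumped (x ∷ xs) A)
      (below-strict (word-above-bumped (x ∷ xs) A) (≮⇒≥ x≮a ∷ all-weaken (≮⇒≥ x≮a) (sorted-head sx)))
      (row-bumping-shifted A (x ∷ xs) ys (suc s) sx (tail-shifted s (x ∷ xs) h))
  ... | false = row-bumping-shifted A (x ∷ xs) (y ∷ ys) s sx h

  row-bumping : ∀ A x y → Sorted x → ColStrict y x → ColStrict (bumped y (newRow x A)) (bumped x A)
  row-bumping A x y sx = row-bumping-shifted A x y zero sx

  insert-above : ∀ w r → ColStrict w r → newRow w r ≡ w × bumped w r ≡ r
  insert-above w       []      _             = newRow-[] w , bumped-[] w
  insert-above (x ∷ w) (a ∷ r) (step x<a cs) with x <ᵇ a | <ᵇ-reflects-< x a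
  ... | true  | _       = cong (x ∷_) (proj₁ (insert-above w r cs)) , cong (a ∷_) (proj₂ (insert-above w r cs))
  ... | false | ofⁿ x≮a = ⊥-elim (x≮a x<a)

  -- Tableaux as lists of rows are compared up to trailing empty rows:
  -- trim deletes them, and Q ≈ Q′ means that Q and Q′ agree after trimming.
  consRow : List ℕ → List (List ℕ) → List (List ℕ)
  consRow []      []      = []
  consRow []      (q ∷ Q) = [] ∷ q ∷ Q
  consRow (x ∷ r) Q       = (x ∷ r) ∷ Q

  trim : List (List ℕ) → List (List ℕ)
  trim []      = []
  trim (r ∷ Q) = consRow r (trim Q)

  infix 4 _≈_
  _≈_ : List (List ℕ) → List (List ℕ) → Set
  Q ≈ Q′ = trim Q ≡ trim Q′

  trim-consRow : ∀ r Q → trim (consRow r Q) ≡ consRow r (trim Q)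
  trim-consRow []      []      = refl
  trim-consRow []      (q ∷ Q) = refl
  trim-consRow (x ∷ r) Q       = refl

  trim-idem : ∀ Q → trim (trim Q) ≡ trim Q
  trim-idem []      = refl
  trim-idem (r ∷ Q) = trans (trim-consRow r (trim Q)) (cong (consRow r) (trim-idem Q))

  ≈-trim : ∀ Q → Q ≈ trim Q
  ≈-trim Q = sym (trim-idem Q)

  padTo-trim : ∀ k Q → padTo k Q ≡ padTo k (trim Q)
  padTo-trim zero    Q       = refl
  padTo-trim (suc k) []      = refl
  padTo-trim (suc k) (r ∷ Q) with trim Q | padTo-trim k Q
  padTo-trim (suc k) ([] ∷ Q)      | []    | eq = cong ([] ∷_) eq
  padTo-trim (suc k) ([] ∷ Q)      | q ∷ S | eq = cong ([] ∷_) eq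
  padTo-trim (suc k) ((x ∷ r) ∷ Q) | S     | eq = cong ((x ∷ r) ∷_) eq

  padTo-≈ : ∀ k {Q Q′} → Q ≈ Q′ → padTo k Q ≡ padTo k Q′
  padTo-≈ k {Q} {Q′} eq = trans (padTo-trim k Q) (trans (cong (padTo k) eq) (sym (padTo-trim k Q′)))

  rowInsert-trim : ∀ x Q → rowInsert x Q ≈ rowInsert x (trim Q)
  rowInsert-trim x []            = refl
  rowInsert-trim x ([] ∷ Q) with trim Q in eq
  ... | []    = refl
  ... | q ∷ S = cong ([ x ] ∷_) (trans (sym eq) (trans (sym (trim-idem Q)) (cong trim eq)))
  rowInsert-trim x ((y ∷ r) ∷ Q) with insertIntoRow x (y ∷ r)
  ... | r′ , nothing = cong (consRow r′) (≈-trim Q)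
  ... | r′ , just z  = cong (consRow r′) (rowInsert-trim z Q)

  insertWord-trim : ∀ w Q → insertWord w Q ≈ insertWord w (trim Q)
  insertWord-trim []      Q = ≈-trim Q
  insertWord-trim (x ∷ w) Q = begin
    trim (insertWord w (rowInsert x Q))                ≡⟨ insertWord-trim w (rowInsert x Q) ⟩
    trim (insertWord w (trim (rowInsert x Q)))         ≡⟨ cong (λ P → trim (insertWord w P)) (rowInsert-trim x Q) ⟩
    trim (insertWord w (trim (rowInsert x (trim Q))))  ≡⟨ sym (insertWord-trim w (rowInsert x (trim Q))) ⟩
    trim (insertWord w (rowInsert x (trim Q)))         ∎
    where open ≡-Reasoning

  insertWord-≈ : ∀ w {Q Q′} → Q ≈ Q′ → insertWord w Q ≈ insertWord w Q′
  insertWord-≈ w {Q} {Q′} eq =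
    trans (insertWord-trim w Q) (trans (cong (λ P → trim (insertWord w P)) eq) (sym (insertWord-trim w Q′)))

  insertWord-row : ∀ w → Sorted w → insertWord w [] ≈ [ w ]
  insertWord-row w sw = begin
    trim (insertWord w [])                        ≡⟨ insertWord-≈ w {[]} {[ [] ]} refl ⟩
    trim (insertWord w [ [] ])                    ≡⟨ cong trim (insertWord-cons w [] [] sw) ⟩
    trim (newRow w [] ∷ insertWord (bumped w []) []) ≡⟨ cong₂ (λ r b → trim (r ∷ insertWord b [])) (newRow-[] w) (bumped-[] w) ⟩
    trim [ w ]                                    ∎
    where open ≡-Reasoning

  ≡⇒≈ : ∀ {Q Q′} → Q ≡ Q′ → Q ≈ Q′
  ≡⇒≈ = cong trim

  IsTableau : List (List ℕ) → Set
  IsTableau Q = All Sorted Q × Linked ColStrict Q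

  tableau-tail : ∀ {r Q} → IsTableau (r ∷ Q) → IsTableau Q
  tableau-tail (sorted , cs) = All.tail sorted , Linked.tail cs

  rows : List ℕ × List (List ℕ) → List (List ℕ)
  rows (u , B) = u ∷ B

  slide : List ℕ → List ℕ × List (List ℕ) → List ℕ × List (List ℕ)
  slide s (u , B) = newRow s u , bumped s u ∷ B

  -- Column insertion of the row R into the tableau ss = s₁ ∷ ⋯ ∷ sₖ: R is
  -- placed under sₖ and moves up through sₖ, …, s₁, each sᵢ being
  -- row-inserted into the current top row.
  colInsert : List ℕ → List (List ℕ) → List ℕ × List (List ℕ)
  colInsert R []       = R , []
  colInsert R (s ∷ ss) = slide s (colInsert R ss)

  colInsert-tableau : ∀ R ss → Sorted R → IsTableau ss → IsTableau (rows (colInsert R ss))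
  colInsert-tableau R []       sR _ = sR ∷ [] , [-]
  colInsert-tableau R (s ∷ []) sR (ss ∷ [] , _) =
    newRow-sorted s R ss sR ∷ bumped-sorted s R sR ∷ [] , newRow-above-bumped s R ss sR ∷ [-]
  colInsert-tableau R (s ∷ s′ ∷ ss) sR (ss₁ ∷ sorted , s-above-s′ ∷ cs)
    with colInsert-tableau R (s′ ∷ ss) sR (sorted , cs)
  ... | su ∷ sorted′ , cs′ =
    newRow-sorted s u ss₁ su ∷ bumped-sorted s u su ∷ sorted′ ,
    newRow-above-bumped s u ss₁ su ∷ row-bumping (proj₁ (colInsert R ss)) s′ s (All.head sorted) s-above-s′ ∷ Linked.tail cs′
    where
    u : List ℕ
    u = proj₁ (colInsert R (s′ ∷ ss))

  colInsert-All : ∀ {P : ℕ → Set} R ss → All P R → All (All P) ss → All (All P) (rows (colInsert R ss))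
  colInsert-All R []       pR _          = pR ∷ []
  colInsert-All R (s ∷ ss) pR (ps ∷ pss) with colInsert-All R ss pR pss
  ... | pu ∷ pB = newRow-All s _ ps pu ∷ bumped-All s _ pu ∷ pB

  colInsert-length : ∀ R ss → length (rows (colInsert R ss)) ≡ length (ss ++ [ R ])
  colInsert-length R []       = refl
  colInsert-length R (s ∷ ss) = cong suc (colInsert-length R ss)

  reading : List (List ℕ) → List ℕ
  reading Q = concat (reverse Q)

  reading-cons : ∀ s Q → reading (s ∷ Q) ≡ reading Q ++ s
  reading-cons s Q = begin
    concat (reverse (s ∷ Q))      ≡⟨ cong concat (unfold-reverse s Q) ⟩
    concat (reverse Q ++ [ s ])   ≡⟨ sym (concat-++ (reverse Q) [ s ]) ⟩
    concat (reverse Q) ++ s ++ [] ≡⟨ cong (concat (reverse Q) ++_) (++-identityʳ s) ⟩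
    concat (reverse Q) ++ s       ∎
    where open ≡-Reasoning

  insert-onto-tableau : ∀ c B → IsTableau (c ∷ B) → insertWord c B ≈ c ∷ B
  insert-onto-tableau c []      (sc ∷ _ , _) = insertWord-row c sc
  insert-onto-tableau c (b ∷ B) (sc ∷ sorted , c-above-b ∷ cs) = begin
    trim (insertWord c (b ∷ B))                   ≡⟨ cong trim (insertWord-cons c b B sc) ⟩
    trim (newRow c b ∷ insertWord (bumped c b) B) ≡⟨ cong₂ (λ r v → trim (r ∷ insertWord v B)) newRow≡c bumped≡b ⟩
    trim (c ∷ insertWord b B)                     ≡⟨ cong (consRow c) (insert-onto-tableau b B (sorted , cs)) ⟩
    trim (c ∷ b ∷ B)                              ∎
    where
    open ≡-Reasoning
    newRow≡c : newRow c b ≡ c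
    newRow≡c = proj₁ (insert-above c b c-above-b)
    bumped≡b : bumped c b ≡ b
    bumped≡b = proj₂ (insert-above c b c-above-b)

  insert-slide : ∀ s C → Sorted s → Sorted (proj₁ C) → IsTableau (proj₂ (slide s C)) →
    insertWord s (rows C) ≈ rows (slide s C)
  insert-slide s (u , B) ss su tB =
    trans (≡⇒≈ (insertWord-cons s u B ss)) (cong (consRow (newRow s u)) (insert-onto-tableau (bumped s u) B tB))

  reading-colInsert : ∀ R ss → Sorted R → IsTableau ss → insertWord (reading (ss ++ [ R ])) [] ≈ rows (colInsert R ss)
  reading-colInsert R [] sR _ = trans (cong (λ w → trim (insertWord w [])) (++-identityʳ R)) (insertWord-row R sR)
  reading-colInsert R (s ∷ ss) sR tss = begin
    trim (insertWord (reading (s ∷ ss ++ [ R ])) [])                ≡⟨ cong (λ w → trim (insertWord w [])) (reading-cons s (ss ++ [ R ])) ⟩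
    trim (insertWord (reading (ss ++ [ R ]) ++ s) [])               ≡⟨ cong trim (foldl-++ _ [] (reading (ss ++ [ R ])) s) ⟩
    trim (insertWord s (insertWord (reading (ss ++ [ R ])) []))     ≡⟨ insertWord-≈ s (reading-colInsert R ss sR (tableau-tail tss)) ⟩
    trim (insertWord s (rows (colInsert R ss)))                     ≡⟨ insert-slide s (colInsert R ss) (All.head (proj₁ tss)) su tBelow ⟩
    trim (rows (colInsert R (s ∷ ss)))                              ∎
    where
    open ≡-Reasoning
    su : Sorted (proj₁ (colInsert R ss))
    su = All.head (proj₁ (colInsert-tableau R ss sR (tableau-tail tss)))
    tBelow : IsTableau (proj₂ (colInsert R (s ∷ ss)))
    tBelow = tableau-tail (colInsert-tableau R (s ∷ ss) sR tss)

  toTabloid-toList : ∀ ℓ rs → toList (toTabloid ℓ rs) ≡ padTo ℓ rs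
  toTabloid-toList zero    rs       = refl
  toTabloid-toList (suc ℓ) []       = cong ([] ∷_) (toTabloid-toList ℓ [])
  toTabloid-toList (suc ℓ) (r ∷ rs) = cong (r ∷_) (toTabloid-toList ℓ rs)

  padTo-length : ∀ k (xs : List (List ℕ)) → length xs ≡ k → padTo k xs ≡ xs
  padTo-length zero    []       _  = refl
  padTo-length (suc k) (x ∷ xs) eq = cong (x ∷_) (padTo-length k xs (suc-injective eq))

  take-prefix : ∀ {A : Set} (xs ys : List A) → take (length xs) (xs ++ ys) ≡ xs
  take-prefix []       ys = refl
  take-prefix (x ∷ xs) ys = cong (x ∷_) (take-prefix xs ys)

  drop-prefix : ∀ {A : Set} (xs ys : List A) → drop (length xs) (xs ++ ys) ≡ ys
  drop-prefix []       ys = refl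
  drop-prefix (x ∷ xs) ys = drop-prefix xs ys

  length-middle : ∀ {A : Set} (p m m′ q : List A) → length m ≡ length m′ → length (p ++ m ++ q) ≡ length (p ++ m′ ++ q)
  length-middle p m m′ q eq
    rewrite length-++ p {m ++ q} | length-++ p {m′ ++ q} | length-++ m {q} | length-++ m′ {q} | eq = refl

  replaceBlock-split : ∀ {ℓ} (V : Tabloid ℓ) pre mid post → toList V ≡ pre ++ mid ++ post →
    toList (replaceBlock (length pre) (length mid) V) ≡
    padTo ℓ (pre ++ padTo (length mid) (insTab (reading mid)) ++ post)
  replaceBlock-split {ℓ} V pre mid post eq = begin
    toList (replaceBlock a b V)         ≡⟨ toTabloid-toList ℓ _ ⟩
    padTo ℓ (block (toList V))           ≡⟨ cong (λ L → padTo ℓ (block L)) eq ⟩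
    padTo ℓ (block (pre ++ mid ++ post)) ≡⟨ cong (padTo ℓ) pieces ⟩
    padTo ℓ (pre ++ padTo b (insTab (reading mid)) ++ post) ∎
    where
    open ≡-Reasoning
    a b : ℕ
    a = length pre
    b = length mid
    block : List (List ℕ) → List (List ℕ)
    block L = take a L ++ padTo b (insTab (reading (take b (drop a L)))) ++ drop (a + b) L
    pieces : block (pre ++ mid ++ post) ≡ pre ++ padTo b (insTab (reading mid)) ++ post
    pieces rewrite sym (drop-drop a b (pre ++ mid ++ post))
                 | take-prefix pre (mid ++ post) | drop-prefix pre (mid ++ post)
                 | take-prefix mid post | drop-prefix mid post = refl

  block-insertion : ∀ {ℓ} (V : Tabloid ℓ) pre ss R post → toList V ≡ pre ++ (ss ++ [ R ]) ++ post →
    Sorted R → IsTableau ss →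
    toList (replaceBlock (length pre) (length (ss ++ [ R ])) V) ≡ pre ++ rows (colInsert R ss) ++ post
  block-insertion {ℓ} V pre ss R post eq sR tss = begin
    toList (replaceBlock (length pre) (length mid) V)             ≡⟨ replaceBlock-split V pre mid post eq ⟩
    padTo ℓ (pre ++ padTo (length mid) (insTab (reading mid)) ++ post)
      ≡⟨ cong (λ X → padTo ℓ (pre ++ X ++ post)) (trans (padTo-≈ (length mid) (reading-colInsert R ss sR tss))
                                                         (padTo-length _ _ (colInsert-length R ss))) ⟩
    padTo ℓ (pre ++ rows C ++ post)                                ≡⟨ padTo-length ℓ _ lengthℓ ⟩
    pre ++ rows C ++ post                                          ∎
    where
    open ≡-Reasoning
    mid : List (List ℕ)
    mid = ss ++ [ R ]
    C : List ℕ × List (List ℕ)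
    C = colInsert R ss
    lengthℓ : length (pre ++ rows C ++ post) ≡ ℓ
    lengthℓ = trans (length-middle pre (rows C) mid post (colInsert-length R ss))
                    (trans (cong length (sym eq)) (length-toList V))

  length-snoc : ∀ {A : Set} (xs : List A) y → length (xs ++ [ y ]) ≡ suc (length xs)
  length-snoc []       y = refl
  length-snoc (x ∷ xs) y = cong suc (length-snoc xs y)

  Pℓ-tableau : ∀ {ℓ} (V : Tabloid ℓ) pre ss R → toList V ≡ pre ++ ss ++ [ R ] → Sorted R → IsTableau ss →
    toList (Pℓ (suc (length pre)) V) ≡ pre ++ rows (colInsert R ss)
  Pℓ-tableau {ℓ} V pre ss R eq sR tss = begin
    toList (replaceBlock p (suc (ℓ ∸ suc p)) V)        ≡⟨ cong (λ b → toList (replaceBlock p b V)) blockSize ⟩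
    toList (replaceBlock p (length (ss ++ [ R ])) V)   ≡⟨ block-insertion V pre ss R [] eq′ sR tss ⟩
    pre ++ rows (colInsert R ss) ++ []                 ≡⟨ cong (pre ++_) (++-identityʳ _) ⟩
    pre ++ rows (colInsert R ss)                       ∎
    where
    open ≡-Reasoning
    p k : ℕ
    p = length pre
    k = length ss
    eq′ : toList V ≡ pre ++ (ss ++ [ R ]) ++ []
    eq′ = trans eq (cong (pre ++_) (sym (++-identityʳ _)))
    ℓ≡ : ℓ ≡ p + suc k
    ℓ≡ = begin
      ℓ                           ≡⟨ sym (length-toList V) ⟩
      length (toList V)           ≡⟨ cong length eq ⟩
      length (pre ++ ss ++ [ R ]) ≡⟨ length-++ pre ⟩
      p + length (ss ++ [ R ])    ≡⟨ cong (p +_) (length-snoc ss R) ⟩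
      p + suc k                   ∎
    blockSize : suc (ℓ ∸ suc p) ≡ length (ss ++ [ R ])
    blockSize = begin
      suc (ℓ ∸ suc p)        ≡⟨ cong (λ n → suc (n ∸ suc p)) (trans ℓ≡ (+-suc p k)) ⟩
      suc (p + k ∸ p)        ≡⟨ cong suc (m+n∸m≡n p k) ⟩
      suc k                  ≡⟨ sym (length-snoc ss R) ⟩
      length (ss ++ [ R ])   ∎

  cyc-inverse-last : ∀ ℓ → heckeInv (cyc ℓ ℓ) ≡ []
  cyc-inverse-last ℓ rewrite n∸n≡0 ℓ = refl

  cyc-inverse-step : ∀ ℓ d → d < ℓ → heckeInv (cyc ℓ d) ≡ d ∷ heckeInv (cyc ℓ (suc d))
  cyc-inverse-step (suc m) d (s≤s d≤m) = begin
    reverse (map f (upTo (suc m ∸ d)))           ≡⟨ cong (λ n → reverse (map f (upTo n))) (+-∸-assoc 1 d≤m) ⟩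
    reverse (map f (upTo (suc (m ∸ d))))         ≡⟨ cong (λ xs → reverse (map f xs)) (sym (upTo-∷ʳ (m ∸ d))) ⟩
    reverse (map f (upTo (m ∸ d) ++ [ m ∸ d ]))  ≡⟨ cong reverse (map-++ f (upTo (m ∸ d)) [ m ∸ d ]) ⟩
    reverse (map f (upTo (m ∸ d)) ++ [ f (m ∸ d) ]) ≡⟨ reverse-++ (map f (upTo (m ∸ d))) [ f (m ∸ d) ] ⟩
    f (m ∸ d) ∷ reverse (map f (upTo (m ∸ d)))   ≡⟨ cong (_∷ reverse (map f (upTo (m ∸ d)))) (m∸[m∸n]≡n d≤m) ⟩
    d ∷ reverse (map f (upTo (m ∸ d)))           ∎
    where
    open ≡-Reasoning
    f : ℕ → ℕ
    f k = m ∸ k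

  length-two-after : ∀ {A : Set} (xs : List A) {y z zs} → suc (length xs) < length (xs ++ y ∷ z ∷ zs)
  length-two-after []       = s≤s (s≤s z≤n)
  length-two-after (x ∷ xs) = s≤s (length-two-after xs)

  -- Second sense: under the same hypotheses, P_{c(i)⁻¹} = P_i P_{i+1} ⋯ P_{ℓ-1}
  -- performs the same column insertion, letting R slide up one row at a time.
  Pcyc-tableau : ∀ {ℓ} (V : Tabloid ℓ) pre ss R → toList V ≡ pre ++ ss ++ [ R ] → Sorted R → IsTableau ss →
    toList (Pw (heckeInv (cyc ℓ (suc (length pre)))) V) ≡ pre ++ rows (colInsert R ss)
  Pcyc-tableau {ℓ} V pre [] R eq sR _ = trans (cong (λ w → toList (Pw w V)) noSteps) eq
    where
    ℓ≡ : ℓ ≡ suc (length pre)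
    ℓ≡ = trans (sym (length-toList V)) (trans (cong length eq) (length-snoc pre R))
    noSteps : heckeInv (cyc ℓ (suc (length pre))) ≡ []
    noSteps = trans (cong (λ d → heckeInv (cyc ℓ d)) (sym ℓ≡)) (cyc-inverse-last ℓ)
  Pcyc-tableau {ℓ} V pre (s ∷ ss) R eq sR tss = begin
    toList (Pw (heckeInv (cyc ℓ (suc p))) V) ≡⟨ cong (λ w → toList (Pw w V)) (cyc-inverse-step ℓ (suc p) sp<ℓ) ⟩
    toList (Pj (suc p) W)                    ≡⟨ block-insertion W pre [ s ] u B eqW su (All.head (proj₁ tss) ∷ [] , [-]) ⟩
    pre ++ rows (colInsert R (s ∷ ss))       ∎
    where
    open ≡-Reasoning
    p : ℕ
    p = length pre
    C : List ℕ × List (List ℕ)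
    C = colInsert R ss
    u : List ℕ
    u = proj₁ C
    B : List (List ℕ)
    B = proj₂ C
    su : Sorted u
    su = All.head (proj₁ (colInsert-tableau R ss sR (tableau-tail tss)))
    -- in W the rows below row p+1 have already been processed
    W : Tabloid ℓ
    W = Pw (heckeInv (cyc ℓ (suc (suc p)))) V
    ih : toList W ≡ (pre ++ [ s ]) ++ rows C
    ih = trans (cong (λ d → toList (Pw (heckeInv (cyc ℓ (suc d))) V)) (sym (length-snoc pre s)))
               (Pcyc-tableau V (pre ++ [ s ]) ss R (trans eq (sym (++-assoc pre [ s ] _))) sR (tableau-tail tss))
    eqW : toList W ≡ pre ++ ([ s ] ++ [ u ]) ++ B
    eqW = trans ih (++-assoc pre [ s ] (rows C))
    sp<ℓ : suc p < ℓ
    sp<ℓ = subst (suc p <_) (trans (cong length (sym eqW)) (length-toList W)) (length-two-after pre)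

  tabloid-ext : ∀ {ℓ} {V W : Tabloid ℓ} → toList V ≡ toList W → V ≡ W
  tabloid-ext {V = V} {W} eq = trans (sym (cast-is-id refl V)) (toList-injective refl V W eq)

  Pcyc≡Pℓ : ∀ {ℓ} (V : Tabloid ℓ) pre ss R → toList V ≡ pre ++ ss ++ [ R ] → Sorted R → IsTableau ss →
    Pw (heckeInv (cyc ℓ (suc (length pre)))) V ≡ Pℓ (suc (length pre)) V
  Pcyc≡Pℓ V pre ss R eq sR tss =
    tabloid-ext (trans (Pcyc-tableau V pre ss R eq sR tss) (sym (Pℓ-tableau V pre ss R eq sR tss)))

  katRow : List ℕ → List ℕ
  katRow r = map (_∸ 1) (removeOnes r)

  notOne? : (x : ℕ) → Dec (¬ (x ≡ 1))
  notOne? x = ¬? (x ≟ 1)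

  InRange : ℕ → ℕ → Set
  InRange B x = 1 ≤ x × x ≤ B

  katRow-sorted : ∀ {r} → Sorted r → Sorted (katRow r)
  katRow-sorted sr = Linkedₚ.map⁺ (Linked.map (∸-monoˡ-≤ 1) (Linkedₚ.filter⁺ notOne? ≤-trans sr))

  katRow-bounded : ∀ {B r} → All (InRange (suc B)) r → All (InRange B) (katRow r)
  katRow-bounded {r = r} bnd =
    Allₚ.map⁺ (All.map lower (All.zip (Allₚ.all-filter notOne? r , Allₚ.filter⁺ notOne? bnd)))
    where
    lower : ∀ {B x} → ¬ (x ≡ 1) × InRange (suc B) x → InRange B (x ∸ 1)
    lower {x = suc zero}    (x≢1 , _)       = ⊥-elim (x≢1 refl)
    lower {x = suc (suc x)} (_ , _ , s≤s x≤B) = s≤s z≤n , x≤B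

  katRow-no-ones : ∀ {r} → ¬ (1 ∈ r) → katRow r ≡ map (_∸ 1) r
  katRow-no-ones {r} 1∉r = cong (map (_∸ 1)) (filter-all notOne? (All.map (λ 1≢x x≡1 → 1≢x (sym x≡1)) (Allₚ.¬Any⇒All¬ r 1∉r)))

  katRow-all-ones : ∀ {r} → All (_≡ 1) r → katRow r ≡ []
  katRow-all-ones ones = cong (map (_∸ 1)) (filter-none notOne? (All.map (λ x≡1 x≢1 → x≢1 x≡1) ones))

  colStrict-pred : ∀ {u v} → All (1 ≤_) u → ColStrict u v → ColStrict (map (_∸ 1) u) (map (_∸ 1) v)
  colStrict-pred _                done                 = done
  colStrict-pred (s≤s z≤n ∷ pos) (step (s≤s x<y) cs) = step x<y (colStrict-pred pos cs)

  PositiveNoOne : List ℕ → Set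
  PositiveNoOne r = ¬ (1 ∈ r) × All (1 ≤_) r

  katRows-colStrict : ∀ {rs} → All PositiveNoOne rs → Linked ColStrict rs → Linked ColStrict (map katRow rs)
  katRows-colStrict _                           []       = []
  katRows-colStrict _                           [-]      = [-]
  katRows-colStrict ((1∉u , pos) ∷ ps@((1∉v , _) ∷ _)) (cs ∷ l) =
    subst₂ ColStrict (sym (katRow-no-ones 1∉u)) (sym (katRow-no-ones 1∉v)) (colStrict-pred pos cs)
    ∷ katRows-colStrict ps l

  katRows-All : ∀ {P Q : List ℕ → Set} → (∀ {r} → P r → Q (katRow r)) → ∀ {rs} → All P rs → All Q (map katRow rs)
  katRows-All f ps = Allₚ.map⁺ (All.map f ps)

  kat-rows : ∀ {ℓ} r (T : Tabloid ℓ) → toList (kat (r ∷ᵥ T)) ≡ map katRow (toList T) ++ [ katRow r ]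
  kat-rows {ℓ} r T = begin
    toList (kat (r ∷ᵥ T))                          ≡⟨ toTabloid-toList (suc ℓ) _ ⟩
    padTo (suc ℓ) (map katRow (toList T ++ [ r ])) ≡⟨ padTo-length (suc ℓ) _ len ⟩
    map katRow (toList T ++ [ r ])                 ≡⟨ map-++ katRow (toList T) [ r ] ⟩
    map katRow (toList T) ++ [ katRow r ]          ∎
    where
    open ≡-Reasoning
    len : length (map katRow (toList T ++ [ r ])) ≡ suc ℓ
    len = trans (length-map katRow (toList T ++ [ r ])) (trans (length-snoc (toList T) r) (cong suc (length-toList T)))

  kat-All : ∀ {ℓ} {P Q : List ℕ → Set} → (∀ {r} → P r → Q (katRow r)) → (T : Tabloid ℓ) →
    All P (toList T) → All Q (toList (kat T))
  kat-All f []ᵥ        _          = []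
  kat-All f (r ∷ᵥ T)  (pr ∷ ps) = subst (All _) (sym (kat-rows r T)) (Allₚ.++⁺ (katRows-All f ps) (f pr ∷ []))

  rows-below : ∀ {c r rs} → All (c ≤_) r → Linked ColStrict (r ∷ rs) → All (All (c <_)) rs
  rows-below c≤r [-]      = []
  rows-below c≤r (cs ∷ l) = below-strict cs c≤r ∷ rows-below (All.map <⇒≤ (below-strict cs c≤r)) l

  ones-in-first-row : ∀ {ℓ} (U : Tabloid ℓ) → All (All (1 ≤_)) (toList U) → Linked ColStrict (toList U) → OnesInFirstRow U
  ones-in-first-row U pos cs with toList U
  ... | []     = []
  ... | r ∷ rs = All.map (λ 1<r 1∈r → <-irrefl refl (All.lookup 1<r 1∈r)) (rows-below (All.head pos) cs)

  linked-drop : ∀ {A : Set} {R : A → A → Set} k {xs} → Linked R xs → Linked R (drop k xs)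
  linked-drop zero    l = l
  linked-drop (suc k) {[]}     _ = []
  linked-drop (suc k) {x ∷ xs} l = linked-drop k (Linked.tail l)

  -- The invariant of a stage T of the katabolism: weakly increasing rows,
  -- entries in [B] (B bounds the number of remaining rounds), and rows
  -- m..ℓ forming a tableau (m being the index of the last round).
  record Invariant {ℓ} (m B : ℕ) (T : Tabloid ℓ) : Set where
    field
      rowsSorted  : All Sorted (toList T)
      rowsBounded : All (All (InRange B)) (toList T)
      tableauFrom : Linked ColStrict (drop (m ∸ 1) (toList T))
  open Invariant

  kat-split : ∀ {ℓ} p r (T : Tabloid ℓ) →
    toList (kat (r ∷ᵥ T)) ≡ map katRow (take p (toList T)) ++ map katRow (drop p (toList T)) ++ [ katRow r ]
  kat-split p r T = begin
    toList (kat (r ∷ᵥ T))                               ≡⟨ kat-rows r T ⟩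
    map katRow L ++ [ katRow r ]                        ≡⟨ cong (λ xs → map katRow xs ++ [ katRow r ]) (sym (take++drop≡id p L)) ⟩
    map katRow (take p L ++ drop p L) ++ [ katRow r ]   ≡⟨ cong (_++ [ katRow r ]) (map-++ katRow (take p L) (drop p L)) ⟩
    (map katRow (take p L) ++ map katRow (drop p L)) ++ [ katRow r ]
                                                        ≡⟨ ++-assoc (map katRow (take p L)) _ _ ⟩
    map katRow (take p L) ++ map katRow (drop p L) ++ [ katRow r ] ∎
    where
    open ≡-Reasoning
    L : List (List ℕ)
    L = toList T

  length-take-rows : ∀ {ℓ} p (T : Tabloid ℓ) → p ≤ ℓ → length (map katRow (take p (toList T))) ≡ p
  length-take-rows p T p≤ℓ = trans (length-map katRow (take p (toList T)))
    (trans (length-take p (toList T)) (m≤n⇒m⊓n≡m (subst (p ≤_) (sym (length-toList T)) p≤ℓ)))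

  -- If r ∷ T satisfies the invariant for m, has its 1's in row 1, and
  -- m ≤ p+2, then its rows p+2, p+3, … lie in the tableau part and contain
  -- no 1, so kat turns them into a tableau.
  kat-tableau-below : ∀ {ℓ m B} p r (T : Tabloid ℓ) → Invariant m B (r ∷ᵥ T) → OnesInFirstRow (r ∷ᵥ T) →
    m ∸ 1 ≤ suc p → IsTableau (map katRow (drop p (toList T)))
  kat-tableau-below {m = m} p r T inv ones m≤ =
    katRows-All katRow-sorted (Allₚ.drop⁺ p (All.tail (rowsSorted inv))) ,
    katRows-colStrict (Allₚ.drop⁺ p (All.zip (ones , All.map (All.map proj₁) (All.tail (rowsBounded inv)))))
                      colStrictBelow
    where
    colStrictBelow : Linked ColStrict (drop p (toList T))
    colStrictBelow = subst (Linked ColStrict)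
      (trans (drop-drop (m ∸ 1) (suc p ∸ (m ∸ 1)) (toList (r ∷ᵥ T))) (cong (λ k → drop k (toList (r ∷ᵥ T))) (m+[n∸m]≡n m≤)))
      (linked-drop (suc p ∸ (m ∸ 1)) (tableauFrom inv))

  invariant-after : ∀ {ℓ B p} (S : Tabloid ℓ) pre ss R → toList S ≡ pre ++ rows (colInsert R ss) → length pre ≡ p →
    All Sorted pre → All (All (InRange B)) pre → IsTableau ss → All (All (InRange B)) ss →
    Sorted R → All (InRange B) R → Invariant (suc p) B S
  invariant-after {B = B} S pre ss R eqS refl sortedPre boundedPre tss boundedSS sR boundedR = record
    { rowsSorted  = subst (All Sorted) (sym eqS) (Allₚ.++⁺ sortedPre (proj₁ tC))
    ; rowsBounded = subst (All (All (InRange B))) (sym eqS) (Allₚ.++⁺ boundedPre (colInsert-All R ss boundedR boundedSS))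
    ; tableauFrom = subst (Linked ColStrict) (sym (trans (cong (drop (length pre)) eqS) (drop-prefix pre _))) (proj₂ tC)
    }
    where
    tC : IsTableau (rows (colInsert R ss))
    tC = colInsert-tableau R ss sR tss

  -- If r ∷ T satisfies the invariant for m with bound B+1, has
  -- its 1's in row 1, and n = p+1 ≥ m-1, then rows n..ℓ of kat (r ∷ T) form
  -- a tableau followed by a row; hence P_{c(n)⁻¹} and P_{n,ℓ} agree on it,
  -- and the result satisfies the invariant for n with bound B.
  kat-round : ∀ {ℓ m B p} r (T : Tabloid ℓ) → Invariant m (suc B) (r ∷ᵥ T) → OnesInFirstRow (r ∷ᵥ T) →
    p ≤ ℓ → m ∸ 1 ≤ suc p →
    Pw (heckeInv (cyc (suc ℓ) (suc p))) (kat (r ∷ᵥ T)) ≡ Pℓ (suc p) (kat (r ∷ᵥ T)) ×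
    Invariant (suc p) B (Pℓ (suc p) (kat (r ∷ᵥ T)))
  kat-round {ℓ} {B = B} {p = p} r T inv ones p≤ℓ m≤ =
    subst (λ q → Pw (heckeInv (cyc (suc ℓ) (suc q))) K ≡ Pℓ (suc q) K) lenPre (Pcyc≡Pℓ K pre ss R split sR tss) ,
    invariant-after (Pℓ (suc p) K) pre ss R eqS lenPre
      (katRows-All katRow-sorted (Allₚ.take⁺ p (All.tail (rowsSorted inv)))) (katRows-All katRow-bounded (Allₚ.take⁺ p bounded))
      tss (katRows-All katRow-bounded (Allₚ.drop⁺ p bounded)) sR (katRow-bounded (All.head (rowsBounded inv)))
    where
    K : Tabloid (suc ℓ)
    K = kat (r ∷ᵥ T)
    pre ss : List (List ℕ)
    pre = map katRow (take p (toList T))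
    ss  = map katRow (drop p (toList T))
    R : List ℕ
    R = katRow r
    split : toList K ≡ pre ++ ss ++ [ R ]
    split = kat-split p r T
    lenPre : length pre ≡ p
    lenPre = length-take-rows p T p≤ℓ
    bounded : All (All (InRange (suc B))) (toList T)
    bounded = All.tail (rowsBounded inv)
    sR : Sorted R
    sR = katRow-sorted (All.head (rowsSorted inv))
    tss : IsTableau ss
    tss = kat-tableau-below p r T inv ones m≤
    eqS : toList (Pℓ (suc p) K) ≡ pre ++ rows (colInsert R ss)
    eqS = subst (λ q → toList (Pℓ (suc q) K) ≡ pre ++ rows (colInsert R ss)) lenPre (Pℓ-tableau K pre ss R split sR tss)

  -- after the last round all entries are 1, so kat empties the tabloid
  kat-empty : ∀ {ℓ m} (T : Tabloid ℓ) → Invariant m 1 T → IsEmptyTabloid (kat T)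
  kat-empty T inv = kat-All (λ b → katRow-all-ones (All.map (λ (1≤x , x≤1) → ≤-antisym x≤1 1≤x) b)) T (rowsBounded inv)

  katabolize-round : ∀ {ℓ} {A : Set} w ws (T S : Tabloid ℓ) → Pw (heckeInv w) T ≡ S →
    (OnesInFirstRow S → A ⇔ WKatabolizable ws (kat S)) → (OnesInFirstRow S × A) ⇔ WKatabolizable (w ∷ ws) T
  katabolize-round w ws T _ refl h =
    mk⇔ (λ (o , a) → o , Equivalence.to (h o) a) (λ (o , k) → o , Equivalence.from (h o) k)

  katabolizable-iff : ∀ {ℓ} ns m (T : Tabloid ℓ) → All (InRange ℓ) ns → Linked (λ a b → a ∸ 1 ≤ b) (m ∷ ns) →
    Invariant m (suc (length ns)) T → OnesInFirstRow T → NKatAux ns T ⇔ WKatabolizable (map (cyc ℓ) ns) (kat T)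
  katabolizable-iff []             m T        _                         _          inv _    =
    mk⇔ (λ _ → kat-empty T inv) (λ _ → tt)
  katabolizable-iff (zero ∷ ns)    m T        ((() , _) ∷ _)            _          _   _
  katabolizable-iff (suc p ∷ ns)   m []ᵥ      ((_ , ()) ∷ _)            _          _   _
  katabolizable-iff {suc ℓ} (suc p ∷ ns) m (r ∷ᵥ T) ((_ , s≤s p≤ℓ) ∷ range) (m≤ ∷ links) inv ones
    with kat-round r T inv ones p≤ℓ m≤
  ... | Pcyc≡S , invS =
    katabolize-round (cyc (suc ℓ) (suc p)) (map (cyc (suc ℓ)) ns) (kat (r ∷ᵥ T)) _ Pcyc≡S
      (katabolizable-iff ns (suc p) _ range links invS)

  links-after-one : ∀ ns → Linked (λ a b → a ∸ 1 ≤ b) ns → Linked (λ a b → a ∸ 1 ≤ b) (1 ∷ ns)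
  links-after-one []      _ = [-]
  links-after-one (n ∷ _) l = z≤n ∷ l

  SSYT-start : ∀ {ℓ q} (μ : Vec ℕ (suc q)) (U : Tabloid ℓ) → SSYT ℓ μ U → Invariant 1 (suc q) U × OnesInFirstRow U
  SSYT-start μ U ((sorted , bounded , _) , _ , colStrict) =
    record { rowsSorted = sorted ; rowsBounded = bounded ; tableauFrom = colStrict } ,
    ones-in-first-row U (All.map (All.map proj₁) bounded) colStrict


open Lemmas
open import Data.Nat using (ℕ; suc; _≤_; _∸_)
open import Data.List using (_∷_; map; length)
open import Data.Vec using (Vec; toList)
open import Data.Vec.Properties using (length-toList)
open import Data.Vec.Relation.Unary.All using (All)
open import Data.Vec.Relation.Unary.All.Properties using (toList⁺)
open import Data.List.Relation.Unary.Linked using (Linked)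
open import Data.Product using (_×_; _,_; proj₁; proj₂)
open import Function.Bundles using (_⇔_; mk⇔; Equivalence)
open import Relation.Binary.PropositionalEquality using (sym; subst)

-- Proposition 6.15: start the round-by-round comparison at U itself; the
-- extra first round (w₁ = id) of the second sense only asks for the 1's of
-- U to lie in its first row, which holds for every semistandard tableau.
proposition6p15 : (ℓ q : ℕ) (μ : Vec ℕ (suc q)) (n : Vec ℕ q)
    → All (λ a → 1 ≤ a × a ≤ ℓ) n
    → Linked (λ a b → a ∸ 1 ≤ b) (toList n)
    → (U : Tabloid ℓ) → SSYT ℓ μ U
    → NKatabolizable n U ⇔ WKatabolizable (heckeId ∷ map (cyc ℓ) (toList n)) U
proposition6p15 ℓ q μ n range links U ssyt =
  mk⇔ (λ k → onesU , Equivalence.to rounds k) (λ (_ , k) → Equivalence.from rounds k)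
  where
  invU : Invariant 1 (suc (length (toList n))) U
  invU = subst (λ k → Invariant 1 (suc k) U) (sym (length-toList n)) (proj₁ (SSYT-start μ U ssyt))
  onesU : OnesInFirstRow U
  onesU = proj₂ (SSYT-start μ U ssyt)
  rounds : NKatAux (toList n) U ⇔ WKatabolizable (map (cyc ℓ) (toList n)) (kat U)
  rounds = katabolizable-iff (toList n) 1 U (toList⁺ range) (links-after-one (toList n) links) invU onesU
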